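{- Every ordered semigroup $(A,\leq,\mathbin{;})$ can be represented as left-total binary relations under inclusion and composition; that is, there exist a set $Y$ and an injective map $\theta:A\to\mathrm{Ltrel}(Y)$ with $\theta(a\mathbin{;}b)=\theta(a)\mathbin{;}\theta(b)$ and $a\leq b\iff\theta(a)\subseteq\theta(b)$.
   Context: An ordered semigroup is $(A,\leq,\mathbin{;})$ with $\mathbin{;}$ associative, $\leq$ a partial order and $\mathbin{;}$ monotone in each argument. $\mathrm{Ltrel}(Y)$ is the set of left total binary relations on $Y$ (domain all of $Y$), and relational composition is $s\mathbin{;}t=\{(x,y):\exists z((x,z)\in s\wedge(z,y)\in t)\}$. -}

module Defs where

open import Level using (0ℓ)
open import Data.Product using (Σ; _×_; _,_; ∃)
open import Relation.Binary.PropositionalEquality using (_≡_)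
open import Relation.Binary.Structures using (IsPartialOrder)
open import Relation.Binary.PropositionalEquality using (isEquivalence)

record OrderedSemigroup : Set₁ where
  field
    Carrier   : Set
    _≤_       : Carrier → Carrier → Set
    _⨾_       : Carrier → Carrier → Carrier
    assoc     : ∀ a b c → (a ⨾ b) ⨾ c ≡ a ⨾ (b ⨾ c)
    isPartialOrder : IsPartialOrder _≡_ _≤_
    monoˡ     : ∀ {a b} c → a ≤ b → (a ⨾ c) ≤ (b ⨾ c)
    monoʳ     : ∀ {a b} c → a ≤ b → (c ⨾ a) ≤ (c ⨾ b)

Rel : Set → Set₁
Rel Y = Y → Y → Set

_∘ʳ_ : {Y : Set} → Rel Y → Rel Y → Rel Y
(s ∘ʳ t) x y = ∃ λ z → s x z × t z y

_⊆ʳ_ : {Y : Set} → Rel Y → Rel Y → Set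
s ⊆ʳ t = ∀ x y → s x y → t x y

_≐ʳ_ : {Y : Set} → Rel Y → Rel Y → Set
s ≐ʳ t = s ⊆ʳ t × t ⊆ʳ s

LeftTotal : {Y : Set} → Rel Y → Set
LeftTotal {Y} s = ∀ x → ∃ λ y → s x y

Ltrel : Set → Set₁
Ltrel Y = Σ (Rel Y) LeftTotal

-- Cayley-style representation: adjoin an identity to A, let A act on the
-- result by right multiplication, and let θ(a) relate x to every element
-- below x·a.  Left totality is reflexivity at x·a; composition works because
-- the action is associative and monotone; and since the adjoined identity is
-- related by θ(a) exactly to the down-set of a, inclusion reflects the order.
module Submission where

open import Defs
open import Data.Product using (Σ; _×_; _,_; proj₁)
open import Data.Maybe using (Maybe; just; nothing)
open import Data.Empty using (⊥)
open import Relation.Binary.PropositionalEquality using (_≡_; refl; sym)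
open import Relation.Binary.Structures using (IsPartialOrder)
open import Function.Bundles using (_⇔_; mk⇔)

module RightRegularRepresentation (A : OrderedSemigroup) where
  open OrderedSemigroup A
  open IsPartialOrder isPartialOrder
    using (antisym; trans; reflexive) renaming (refl to ≤-refl)

  infixl 30 _·_

  _·_ : Maybe Carrier → Carrier → Carrier
  nothing · a = a
  just x  · a = x ⨾ a

  ·-assoc : ∀ x a b → x · (a ⨾ b) ≡ (x · a) ⨾ b
  ·-assoc nothing  a b = refl
  ·-assoc (just x) a b = sym (assoc x a b)

  ·-monoʳ : ∀ x {a b} → a ≤ b → x · a ≤ x · b
  ·-monoʳ nothing  a≤b = a≤b
  ·-monoʳ (just x) a≤b = monoʳ x a≤b

  below : Carrier → Rel (Maybe Carrier)
  below a x nothing  = ⊥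
  below a x (just y) = y ≤ x · a

  below-leftTotal : ∀ a → LeftTotal (below a)
  below-leftTotal a x = just (x · a) , ≤-refl

  θ : Carrier → Ltrel (Maybe Carrier)
  θ a = below a , below-leftTotal a

  below-mono : ∀ {a b} → a ≤ b → below a ⊆ʳ below b
  below-mono a≤b x (just y) y≤xa = trans y≤xa (·-monoʳ x a≤b)

  below-reflects : ∀ {a b} → below a ⊆ʳ below b → a ≤ b
  below-reflects {a} a⊆b = a⊆b nothing (just a) ≤-refl

  below-injective : ∀ {a b} → below a ≐ʳ below b → a ≡ b
  below-injective (a⊆b , b⊆a) = antisym (below-reflects a⊆b) (below-reflects b⊆a)

  below-⨾-⊆ : ∀ a b → below (a ⨾ b) ⊆ʳ (below a ∘ʳ below b)
  below-⨾-⊆ a b x (just y) y≤x[ab] =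
    just (x · a) , ≤-refl , trans y≤x[ab] (reflexive (·-assoc x a b))

  below-⨾-⊇ : ∀ a b → (below a ∘ʳ below b) ⊆ʳ below (a ⨾ b)
  below-⨾-⊇ a b x (just y) (just z , z≤xa , y≤zb) =
    trans y≤zb (trans (monoˡ b z≤xa) (reflexive (sym (·-assoc x a b))))

  below-⨾ : ∀ a b → below (a ⨾ b) ≐ʳ (below a ∘ʳ below b)
  below-⨾ a b = below-⨾-⊆ a b , below-⨾-⊇ a b

mainTheorem17 : (A : OrderedSemigroup) → let open OrderedSemigroup A in
    Σ Set λ Y → Σ (Carrier → Ltrel Y) λ θ →
    (∀ a b → proj₁ (θ a) ≐ʳ proj₁ (θ b) → a ≡ b)
    × (∀ a b → proj₁ (θ (a ⨾ b)) ≐ʳ (proj₁ (θ a) ∘ʳ proj₁ (θ b)))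
    × (∀ a b → (a ≤ b) ⇔ (proj₁ (θ a) ⊆ʳ proj₁ (θ b)))
mainTheorem17 A =
  Maybe Carrier , θ ,
  (λ _ _ → below-injective) ,
  below-⨾ ,
  (λ _ _ → mk⇔ below-mono below-reflects)
  where
  open OrderedSemigroup A using (Carrier)
  open RightRegularRepresentation A
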